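{- Let $G$ be a finite graph (loopless, possibly with multiple edges), and let $\Delta$ and $\delta$ denote its maximum and minimum degree, respectively. Then $\check{s}(G)=2$ if and only if $\Delta>\delta$ and $G$ can be decomposed into at most two Class 1 regular subgraphs $H_0$ and $H_1$ (either of which may be absent from the decomposition) such that - $H_0$, if present, is spanning and $\delta$-regular; - $H_1$, if present, is $(\Delta-\delta)$-regular.
   Context: A $k$-edge-coloring of $G$ is a map $c\colon E(G)\to\{1,\dots,k\}$ such that any two distinct edges sharing an endpoint receive different colors. The palette of a vertex $v$ with respect to $c$ is $P_c(v)=\{c(e): e \text{ incident with } v\}$ (empty if $v$ is isolated). The palette index $\check{s}(G)$ is the minimum, over all edge-colorings $c$ of $G$ (with any number of colors), of the number of distinct palettes $P_c(v)$, $v\in V(G)$. A graph with maximum degree $\Delta$ is Class 1 if it admits a $\Delta$-edge-coloring; so an $r$-regular graph is Class 1 iff it admits an $r$-edge-coloring. A decomposition of $G$ is a family $\{H_i\}$ of subgraphs of $G$, each with nonempty edge set, whose edge sets are pairwise disjoint and have union $E(G)$. A subgraph is spanning if its vertex set is $V(G)$. -}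

module Defs where

open import Data.Nat using (ℕ; _<_; _≤_; _∸_)
open import Data.Fin using (Fin; _≟_)
open import Data.Bool using (Bool; true; false)
import Data.Bool as B
open import Data.List using (List; length; filter; allFin)
open import Data.Product using (Σ; ∃; _×_; _,_)
open import Data.Sum using (_⊎_)
open import Relation.Nullary using (¬_; Dec)
open import Relation.Nullary.Decidable using (_⊎-dec_; _×-dec_)
open import Relation.Binary.PropositionalEquality using (_≡_; _≢_)
open import Function.Bundles using (_⇔_)

record Multigraph : Set where
  field
    n : ℕ
    m : ℕ
    src : Fin m → Fin n
    tgt : Fin m → Fin n
    loopless : ∀ e → src e ≢ tgt e

module _ (G : Multigraph) where
  open Multigraph G

  Inc : Fin m → Fin n → Set
  Inc e v = (src e ≡ v) ⊎ (tgt e ≡ v)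

  inc? : ∀ e v → Dec (Inc e v)
  inc? e v = (src e ≟ v) ⊎-dec (tgt e ≟ v)

  Adjacent : Fin m → Fin m → Set
  Adjacent e e' = (e ≢ e') × ∃ λ v → Inc e v × Inc e' v

  deg : Fin n → ℕ
  deg v = length (filter (λ e → inc? e v) (allFin m))

  degIn : (Fin m → Bool) → Fin n → ℕ
  degIn S v = length (filter (λ e → (S e B.≟ true) ×-dec inc? e v) (allFin m))

  IsMaxDegree : ℕ → Set
  IsMaxDegree Δ = (∃ λ v → deg v ≡ Δ) × (∀ v → deg v ≤ Δ)

  IsMinDegree : ℕ → Set
  IsMinDegree δ = (∃ λ v → deg v ≡ δ) × (∀ v → δ ≤ deg v)

  IsEdgeColoring : (Fin m → ℕ) → Set
  IsEdgeColoring c = ∀ e e' → Adjacent e e' → c e ≢ c e'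

  _∈Palette[_]_ : ℕ → (Fin m → ℕ) → Fin n → Set
  k ∈Palette[ c ] v = ∃ λ e → Inc e v × c e ≡ k

  SamePalette : (Fin m → ℕ) → Fin n → Fin n → Set
  SamePalette c u v = ∀ k → (k ∈Palette[ c ] u) ⇔ (k ∈Palette[ c ] v)

  -- the number of distinct palettes of c is at most k:
  -- there are k vertices whose palettes include every palette.
  AtMostPalettes : (Fin m → ℕ) → ℕ → Set
  AtMostPalettes c k =
    Σ (Fin k → Fin n) λ w → ∀ v → ∃ λ i → SamePalette c v (w i)

  PaletteIndex≤ : ℕ → Set
  PaletteIndex≤ k = Σ (Fin m → ℕ) λ c → IsEdgeColoring c × AtMostPalettes c k

  PaletteIndex≡ : ℕ → Set
  PaletteIndex≡ 0 = PaletteIndex≤ 0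
  PaletteIndex≡ (ℕ.suc k) = PaletteIndex≤ (ℕ.suc k) × ¬ PaletteIndex≤ k

  HasColoringIn : (Fin m → Bool) → ℕ → Set
  HasColoringIn S k =
    Σ (Fin m → Fin k) λ c →
      ∀ e e' → S e ≡ true → S e' ≡ true → Adjacent e e' → c e ≢ c e'

  -- Decomposition of G into at most two subgraphs H₀, H₁:
  -- edge e goes to H₀ if side e ≡ false, to H₁ if side e ≡ true.
  -- H₀ (present iff it has an edge) is spanning, δ-regular and Class 1;
  -- H₁ (present iff it has an edge) has vertex set {v | V₁ v ≡ true}
  -- containing all endpoints of its edges, is (Δ-δ)-regular and Class 1.
  GoodDecomposition : ℕ → ℕ → Set
  GoodDecomposition Δ δ =
    Σ (Fin m → Bool) λ side →
    Σ (Fin n → Bool) λ V₁ →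
      (∀ e → side e ≡ true → (V₁ (src e) ≡ true) × (V₁ (tgt e) ≡ true))
    × ((∃ λ e → side e ≡ false) →
         (∀ v → degIn (λ e → B.not (side e)) v ≡ δ)
       × HasColoringIn (λ e → B.not (side e)) δ)
    × ((∃ λ e → side e ≡ true) →
         (∀ v → V₁ v ≡ true → degIn side v ≡ Δ ∸ δ)
       × HasColoringIn side (Δ ∸ δ))

-- If H₀ and H₁ are given, colour H₀ with 0, …, δ-1 and H₁ with δ, …, Δ-1. A vertex of H₀ of full
-- degree δ sees every colour of H₀, and likewise for H₁ on its vertex set, so the vertices of H₁
-- have palette {0, …, Δ-1} and all others {0, …, δ-1}. A proper colouring gives equal palettes only
-- to vertices of equal degree, so δ < Δ rules out a single palette.
--
-- Conversely, let a₀ and b₀ carry the two palettes A and B, with |B| ≤ |A|. While some colour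
-- b ∈ B is missing from A, pick a ∈ A ∖ B and recolour the edges coloured b with a: every vertex
-- sees A or B, so no vertex sees both a and b, the colouring stays proper with palettes A and
-- B ∖ {b} ∪ {a}, and |B ∖ A| drops. Once B ⊆ A, the edges coloured from B form H₀, spanning and
-- |B|-regular, and those coloured from A ∖ B form H₁, regular of degree |A| - |B| on the vertices
-- with palette A; |A| = |B| would give a single palette.
module Submission where

open import Defs
open import Data.Bool using (Bool; true; false; not; if_then_else_)
import Data.Bool as Bool
open import Data.Bool.Properties using (¬-not; not-injective)
open import Data.Empty using (⊥; ⊥-elim)
open import Data.Fin using (Fin; zero; suc; toℕ)
import Data.Fin as Fin
open import Data.Fin.Properties using (toℕ<n; toℕ-injective; any?)
open import Data.List using (List; []; _∷_; length; map; filter; allFin; lookup)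
open import Data.List.Properties
  using (length-map; length-filter; length-tabulate; map-cong-local; filter-some)
open import Data.List.Membership.Propositional using (_∈_; _∉_; find; lose)
open import Data.List.Membership.Propositional.Properties
  using (∈-map⁺; ∈-map⁻; ∈-filter⁺; ∈-filter⁻; ∈-allFin)
open import Data.List.Membership.Propositional.Properties.WithK using (unique∧set⇒bag)
import Data.List.Membership.DecPropositional as DecMembership
open import Data.List.Relation.Binary.BagAndSetEquality using (∼bag⇒↭)
open import Data.List.Relation.Binary.Permutation.Propositional.Properties using (↭-length)
open import Data.List.Relation.Binary.Subset.Propositional using (_⊆_)
import Data.List.Relation.Unary.All as All
import Data.List.Relation.Unary.All.Properties as All
open import Data.List.Relation.Unary.AllPairs using ([]; _∷_)
open import Data.List.Relation.Unary.Any as Any using (here; there; index)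
open import Data.List.Relation.Unary.Any.Properties using (lookup-index)
open import Data.List.Relation.Unary.Unique.Propositional using (Unique)
import Data.List.Relation.Unary.Unique.Propositional.Properties as Unique
open import Data.Nat using (ℕ; zero; suc; _≤_; _<_; _+_; _∸_; z≤n; s≤s)
import Data.Nat as ℕ
open import Data.Nat.Properties
  using ( ≤-refl; ≤-reflexive; ≤-trans; ≤-total; ≤-pred; <-irrefl; <⇒≢; <-≤-trans; n≮0
        ; +-suc; +-cancelˡ-≡; m≤m+n; m≤n⇒m≤1+n; m≤n⇒m<n∨m≡n; m+n∸m≡n; module ≤-Reasoning)
open import Data.Product using (∃; ∃₂; _×_; _,_; proj₁; proj₂)
open import Data.Sum using (_⊎_; inj₁; inj₂; [_,_]′)
import Data.Sum as Sum
open import Data.Unit using (⊤; tt)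
open import Function using (_∘_; const)
open import Function.Bundles using (_⇔_; mk⇔; Equivalence)
open import Function.Construct.Composition using (_⇔-∘_)
open import Level using (0ℓ)
open import Relation.Binary.Definitions using (DecidableEquality)
open import Relation.Binary.PropositionalEquality
  using (_≡_; _≢_; refl; sym; trans; cong; cong₂; subst; subst₂; module ≡-Reasoning)
open import Relation.Nullary using (¬_; Dec; yes; no; ¬?; does; _×-dec_)
open import Relation.Nullary.Decidable using (decidable-stable)
open import Relation.Unary using (Pred; Decidable)

open Equivalence using (to; from)

module _ {A : Set} where

  unique-∼set⇒length≡ : {xs ys : List A} → Unique xs → Unique ys →
                        (∀ {x} → x ∈ xs ⇔ x ∈ ys) → length xs ≡ length ys
  unique-∼set⇒length≡ xs! ys! xs∼ys = ↭-length (∼bag⇒↭ (unique∧set⇒bag xs! ys! xs∼ys))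

  map⁺-injectiveOn : {B : Set} (f : A → B) {xs : List A} →
                     (∀ {x y} → x ∈ xs → y ∈ xs → x ≢ y → f x ≢ f y) →
                     Unique xs → Unique (map f xs)
  map⁺-injectiveOn f inj [] = []
  map⁺-injectiveOn f inj (x∉xs ∷ xs!) =
    All.map⁺ (All.tabulate (λ y∈ → inj (here refl) (there y∈) (All.lookup x∉xs y∈)))
    ∷ map⁺-injectiveOn f (λ x∈ y∈ → inj (there x∈) (there y∈)) xs!

  length-filter+length-filter-¬ : {P : Pred A 0ℓ} (P? : Decidable P) (xs : List A) →
    length (filter P? xs) + length (filter (¬? ∘ P?) xs) ≡ length xs
  length-filter+length-filter-¬ P? [] = refl
  length-filter+length-filter-¬ P? (x ∷ xs) with P? x
  ... | yes _ = cong suc (length-filter+length-filter-¬ P? xs)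
  ... | no _ = trans (+-suc _ _) (cong suc (length-filter+length-filter-¬ P? xs))

module _ {A : Set} (_≟_ : DecidableEquality A) where

  open DecMembership _≟_ using (_∈?_; _∉?_)

  ⊆-or-∃∉ : (xs ys : List A) → xs ⊆ ys ⊎ ∃ λ x → x ∈ xs × x ∉ ys
  ⊆-or-∃∉ xs ys with Any.any? (_∉? ys) xs
  ... | yes some∉ = inj₂ (find some∉)
  ... | no ¬some∉ = inj₁ (λ {x} x∈xs →
          decidable-stable (x ∈? ys) (λ x∉ys → ¬some∉ (Any.map (λ { refl → x∉ys }) x∈xs)))

  length-filter-∈ : {xs ys : List A} → Unique xs → Unique ys → ys ⊆ xs →
    length (filter (_∈? ys) xs) ≡ length ys
  length-filter-∈ {xs} {ys} xs! ys! ys⊆xs = unique-∼set⇒length≡ (Unique.filter⁺ (_∈? ys) xs!) ys!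
    (mk⇔ (proj₂ ∘ ∈-filter⁻ (_∈? ys) {xs = xs}) (λ y∈ → ∈-filter⁺ (_∈? ys) (ys⊆xs y∈) y∈))

  unique-⊆⇒length≤ : {xs ys : List A} → Unique xs → Unique ys → xs ⊆ ys → length xs ≤ length ys
  unique-⊆⇒length≤ {xs} {ys} xs! ys! xs⊆ys =
    subst (_≤ length ys) (length-filter-∈ ys! xs! xs⊆ys) (length-filter (_∈? xs) ys)

  unique-⊆-length≥⇒⊇ : {xs ys : List A} → Unique xs → Unique ys → xs ⊆ ys →
                       length ys ≤ length xs → ys ⊆ xs
  unique-⊆-length≥⇒⊇ {xs} {ys} xs! ys! xs⊆ys ys≤xs {z} z∈ys = decidable-stable (z ∈? xs) λ z∉xs →
    <-irrefl refl (≤-trans (unique-⊆⇒length≤ (All.tabulate (λ { x∈ refl → z∉xs x∈ }) ∷ xs!) ys!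
                                             λ { (here refl) → z∈ys ; (there x∈) → xs⊆ys x∈ })
                           ys≤xs)

  unique-length≤-∉⇒∃∉ : {xs ys : List A} {y : A} → Unique xs → Unique ys →
    length ys ≤ length xs → y ∈ ys → y ∉ xs → ∃ λ x → x ∈ xs × x ∉ ys
  unique-length≤-∉⇒∃∉ {xs} {ys} xs! ys! ys≤xs y∈ys y∉xs with ⊆-or-∃∉ xs ys
  ... | inj₂ x = x
  ... | inj₁ xs⊆ys = ⊥-elim (y∉xs (unique-⊆-length≥⇒⊇ xs! ys! xs⊆ys ys≤xs y∈ys))

  length-filter-∉ : {xs ys : List A} → Unique xs → Unique ys → ys ⊆ xs →
    length (filter (_∉? ys) xs) ≡ length xs ∸ length ys
  length-filter-∉ {xs} {ys} xs! ys! ys⊆xs = begin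
    length outside                              ≡⟨ m+n∸m≡n (length ys) _ ⟨
    length ys + length outside ∸ length ys      ≡⟨ cong (λ k → k + length outside ∸ length ys) inside≡ ⟨
    length inside + length outside ∸ length ys  ≡⟨ cong (_∸ length ys) split ⟩
    length xs ∸ length ys                       ∎
    where
    open ≡-Reasoning
    inside outside : List A
    inside = filter (_∈? ys) xs
    outside = filter (_∉? ys) xs
    inside≡ : length inside ≡ length ys
    inside≡ = length-filter-∈ xs! ys! ys⊆xs
    split : length inside + length outside ≡ length xs
    split = length-filter+length-filter-¬ (_∈? ys) xs

module _ {X A : Set} {P : Pred A 0ℓ} (P? : Decidable P) (g h : X → A)
         (h⇒g : ∀ x → P (h x) → P (g x)) where

  length-filter-map-≤ : ∀ xs → length (filter P? (map h xs)) ≤ length (filter P? (map g xs))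
  length-filter-map-≤ [] = z≤n
  length-filter-map-≤ (x ∷ xs) with P? (h x) | P? (g x)
  ... | yes _ | yes _ = s≤s (length-filter-map-≤ xs)
  ... | yes p | no ¬q = ⊥-elim (¬q (h⇒g x p))
  ... | no _ | yes _ = m≤n⇒m≤1+n (length-filter-map-≤ xs)
  ... | no _ | no _ = length-filter-map-≤ xs

  length-filter-map-< : ∀ xs {x} → x ∈ xs → P (g x) → ¬ P (h x) →
    length (filter P? (map h xs)) < length (filter P? (map g xs))
  length-filter-map-< (y ∷ xs) x∈ pg ¬ph with P? (h y) | P? (g y) | x∈
  ... | yes p | no ¬q | _ = ⊥-elim (¬q (h⇒g y p))
  ... | yes p | _ | here refl = ⊥-elim (¬ph p)
  ... | no _ | no ¬q | here refl = ⊥-elim (¬q pg)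
  ... | no _ | yes _ | here refl = s≤s (length-filter-map-≤ xs)
  ... | yes _ | yes _ | there x∈xs = s≤s (length-filter-map-< xs x∈xs pg ¬ph)
  ... | no _ | yes _ | there x∈xs = m≤n⇒m≤1+n (length-filter-map-< xs x∈xs pg ¬ph)
  ... | no _ | no _ | there x∈xs = length-filter-map-< xs x∈xs pg ¬ph

open DecMembership ℕ._≟_ using (_∈?_; _∉?_)

module _ (G : Multigraph) where
  open Multigraph G

  ProperOn : {C : Set} → (Fin m → Bool) → (Fin m → C) → Set
  ProperOn S col = ∀ e e' → S e ≡ true → S e' ≡ true → Adjacent G e e' → col e ≢ col e'

  edgesAt : Fin n → List (Fin m)
  edgesAt v = filter (λ e → inc? G e v) (allFin m)

  edgesIn : (Fin m → Bool) → Fin n → List (Fin m)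
  edgesIn S v = filter (λ e → (S e Bool.≟ true) ×-dec inc? G e v) (allFin m)

  ∈-edgesAt⁻ : ∀ {e v} → e ∈ edgesAt v → Inc G e v
  ∈-edgesAt⁻ = proj₂ ∘ ∈-filter⁻ (λ e → inc? G e _) {xs = allFin m}

  ∈-edgesIn⁻ : ∀ {S e v} → e ∈ edgesIn S v → S e ≡ true × Inc G e v
  ∈-edgesIn⁻ {S} = proj₂ ∘ ∈-filter⁻ (λ e → (S e Bool.≟ true) ×-dec inc? G e _) {xs = allFin m}

  ∈-edgesIn⁺ : ∀ {S e v} → S e ≡ true → Inc G e v → e ∈ edgesIn S v
  ∈-edgesIn⁺ {S} {e} e∈S e~v =
    ∈-filter⁺ (λ e → (S e Bool.≟ true) ×-dec inc? G e _) (∈-allFin e) (e∈S , e~v)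

  coloursAt : (Fin m → ℕ) → Fin n → List ℕ
  coloursAt c v = map c (edgesAt v)

  ∈-coloursAt⇔∈Palette : ∀ {c v k} → k ∈ coloursAt c v ⇔ _∈Palette[_]_ G k c v
  ∈-coloursAt⇔∈Palette {c} {v} = mk⇔ colour⇒palette palette⇒colour
    where
    colour⇒palette : ∀ {k} → k ∈ coloursAt c v → _∈Palette[_]_ G k c v
    colour⇒palette k∈ with ∈-map⁻ c k∈
    ... | e , e∈ , refl = e , ∈-edgesAt⁻ e∈ , refl
    palette⇒colour : ∀ {k} → _∈Palette[_]_ G k c v → k ∈ coloursAt c v
    palette⇒colour (e , e~v , refl) = ∈-map⁺ c (∈-filter⁺ (λ e → inc? G e v) (∈-allFin e) e~v)

  length-coloursAt : ∀ c v → length (coloursAt c v) ≡ deg G v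
  length-coloursAt c v = length-map c (edgesAt v)

  coloursAt-unique : ∀ {c} → IsEdgeColoring G c → ∀ v → Unique (coloursAt c v)
  coloursAt-unique proper v = map⁺-injectiveOn _
    (λ e∈ e'∈ e≢e' → proper _ _ (e≢e' , v , ∈-edgesAt⁻ e∈ , ∈-edgesAt⁻ e'∈))
    (Unique.filter⁺ _ (Unique.allFin⁺ m))

  coloursIn-unique : ∀ {C S v} {col : Fin m → C} → ProperOn S col → Unique (map col (edgesIn S v))
  coloursIn-unique {v = v} proper = map⁺-injectiveOn _
    (λ e∈ e'∈ e≢e' → let (e∈S , e~v) = ∈-edgesIn⁻ e∈ ; (e'∈S , e'~v) = ∈-edgesIn⁻ e'∈
                    in proper _ _ e∈S e'∈S (e≢e' , v , e~v , e'~v))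
    (Unique.filter⁺ _ (Unique.allFin⁺ m))

  samePalette⇒deg≡ : ∀ {c u v} → IsEdgeColoring G c → SamePalette G c u v → deg G u ≡ deg G v
  samePalette⇒deg≡ {c} {u} {v} proper same = begin
    deg G u                 ≡⟨ length-coloursAt c u ⟨
    length (coloursAt c u)  ≡⟨ unique-∼set⇒length≡ (coloursAt-unique proper u) (coloursAt-unique proper v)
                                 (mk⇔ (transport (to (same _))) (transport (from (same _)))) ⟩
    length (coloursAt c v)  ≡⟨ length-coloursAt c v ⟩
    deg G v                 ∎
    where
    open ≡-Reasoning
    transport : ∀ {k x y} → (_∈Palette[_]_ G k c x → _∈Palette[_]_ G k c y) →
                k ∈ coloursAt c x → k ∈ coloursAt c y
    transport x⇒y = from ∈-coloursAt⇔∈Palette ∘ x⇒y ∘ to ∈-coloursAt⇔∈Palette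

  samePalette-∘ : ∀ {c u v} (f : ℕ → ℕ) → SamePalette G c u v → SamePalette G (f ∘ c) u v
  samePalette-∘ {c} f same k = mk⇔ (transport (to (same _))) (transport (from (same _)))
    where
    transport : ∀ {x y} → (∀ {j} → _∈Palette[_]_ G j c x → _∈Palette[_]_ G j c y) →
                _∈Palette[_]_ G k (f ∘ c) x → _∈Palette[_]_ G k (f ∘ c) y
    transport x⇒y (e , e~x , refl) with e' , e'~y , same' ← x⇒y (e , e~x , refl) = e' , e'~y , cong f same'

  onePalette⇒deg≡ : PaletteIndex≤ G 1 → ∀ u v → deg G u ≡ deg G v
  onePalette⇒deg≡ (c , proper , w , covers) u v with covers u | covers v
  ... | zero , u~w | zero , v~w = trans (samePalette⇒deg≡ proper u~w) (sym (samePalette⇒deg≡ proper v~w))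

  degIn≡length : ∀ {c S v} (X : List ℕ) → IsEdgeColoring G c → Unique X →
    (∀ e → S e ≡ true → Inc G e v → c e ∈ X) →
    (∀ {x} → x ∈ X → ∃ λ e → S e ≡ true × Inc G e v × c e ≡ x) →
    degIn G S v ≡ length X
  degIn≡length {c} {S} {v} X proper X! coloursInX allOfX = begin
    degIn G S v                   ≡⟨ length-map c (edgesIn S v) ⟨
    length (map c (edgesIn S v))  ≡⟨ unique-∼set⇒length≡ (coloursIn-unique (λ e e' _ _ → proper e e')) X!
                                       (mk⇔ into onto) ⟩
    length X                      ∎
    where
    open ≡-Reasoning
    into : ∀ {x} → x ∈ map c (edgesIn S v) → x ∈ X
    into x∈ with e , e∈ , refl ← ∈-map⁻ c x∈ = coloursInX e (proj₁ (∈-edgesIn⁻ e∈)) (proj₂ (∈-edgesIn⁻ e∈))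
    onto : ∀ {x} → x ∈ X → x ∈ map c (edgesIn S v)
    onto x∈ with e , e∈S , e~v , refl ← allOfX x∈ = ∈-map⁺ c (∈-edgesIn⁺ e∈S e~v)

  fullDegree⇒allColoursAt : ∀ {S v K} {col : Fin m → Fin K} → ProperOn S col → degIn G S v ≡ K →
    ∀ j → ∃ λ e → S e ≡ true × Inc G e v × col e ≡ j
  fullDegree⇒allColoursAt {S} {v} {K} {col} proper degK j = witness (∈-map⁻ col j∈)
    where
    enough : length (allFin K) ≤ length (map col (edgesIn S v))
    enough = ≤-reflexive (trans (length-tabulate _) (trans (sym degK) (sym (length-map col (edgesIn S v)))))
    j∈ : j ∈ map col (edgesIn S v)
    j∈ = unique-⊆-length≥⇒⊇ Fin._≟_ (coloursIn-unique proper) (Unique.allFin⁺ K) (λ _ → ∈-allFin _) enough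
           (∈-allFin j)
    witness : (∃ λ e → e ∈ edgesIn S v × j ≡ col e) → ∃ λ e → S e ≡ true × Inc G e v × col e ≡ j
    witness (e , e∈ , refl) = let (e∈S , e~v) = ∈-edgesIn⁻ e∈ in e , e∈S , e~v , refl

  -- Colour e by the position of c e in X; the edge e₀ only serves to make Fin (length X) inhabited.
  colouringFromList : ∀ {c S} (X : List ℕ) → IsEdgeColoring G c → (∀ e → S e ≡ true → c e ∈ X) →
    (∃ λ e → S e ≡ true) → HasColoringIn G S (length X)
  colouringFromList {c} {S} X proper coloursInX (e₀ , e₀∈S) = position , properPosition
    where
    position : Fin m → Fin (length X)
    position e with c e ∈? X
    ... | yes c[e]∈X = index c[e]∈X
    ... | no _ = index (coloursInX e₀ e₀∈S)
    lookup-position : ∀ e → S e ≡ true → lookup X (position e) ≡ c e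
    lookup-position e e∈S with c e ∈? X
    ... | yes c[e]∈X = sym (lookup-index c[e]∈X)
    ... | no c[e]∉X = ⊥-elim (c[e]∉X (coloursInX e e∈S))
    properPosition : ProperOn S position
    properPosition e e' e∈S e'∈S adj same = proper e e' adj (begin
      c e                     ≡⟨ lookup-position e e∈S ⟨
      lookup X (position e)   ≡⟨ cong (lookup X) same ⟩
      lookup X (position e')  ≡⟨ lookup-position e' e'∈S ⟩
      c e'                    ∎)
      where open ≡-Reasoning

  record SpreadColouring (S : Fin m → Bool) (Good : Fin n → Set) (K : ℕ) : Set where
    field
      colour : Fin m → ℕ
      colour<K : ∀ e → S e ≡ true → colour e < K
      proper : ProperOn S colour
      spread : ∀ e → S e ≡ true → ∀ u → Good u →
               ∃ λ e' → S e' ≡ true × Inc G e' u × colour e' ≡ colour e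

  spreadColouring : ∀ {S Good K} → Dec (∃ λ e → S e ≡ true) →
    ((∃ λ e → S e ≡ true) → (∀ v → Good v → degIn G S v ≡ K) × HasColoringIn G S K) →
    SpreadColouring S Good K
  spreadColouring (no noEdge) _ = record
    { colour = const 0
    ; colour<K = λ e e∈S → ⊥-elim (noEdge (e , e∈S))
    ; proper = λ e _ e∈S _ _ _ → noEdge (e , e∈S)
    ; spread = λ e e∈S _ _ → ⊥-elim (noEdge (e , e∈S))
    }
  spreadColouring (yes someEdge) present with regular , col , proper ← present someEdge = record
    { colour = toℕ ∘ col
    ; colour<K = λ e _ → toℕ<n (col e)
    ; proper = λ e e' e∈S e'∈S adj → proper e e' e∈S e'∈S adj ∘ toℕ-injective
    ; spread = λ e _ u good →
        let (e' , e'∈S , e'~u , same) = fullDegree⇒allColoursAt proper (regular u good) (col e)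
        in e' , e'∈S , e'~u , cong toℕ same
    }

module CombinedColouring (G : Multigraph) {δ K : ℕ}
                     (side : Fin (Multigraph.m G) → Bool) (V₁ : Fin (Multigraph.n G) → Bool)
                     (H₁⊆V₁ : ∀ {e u} → Inc G e u → side e ≡ true → V₁ u ≡ true)
                     (C₀ : SpreadColouring G (not ∘ side) (const ⊤) δ)
                     (C₁ : SpreadColouring G side (λ v → V₁ v ≡ true) K) where
  open Multigraph G
  module C₀ = SpreadColouring C₀
  module C₁ = SpreadColouring C₁

  colour : Fin m → ℕ
  colour e = if side e then δ + C₁.colour e else C₀.colour e

  colour-H₀ : ∀ e → side e ≡ false → colour e ≡ C₀.colour e
  colour-H₀ e e∈H₀ rewrite e∈H₀ = refl

  colour-H₁ : ∀ e → side e ≡ true → colour e ≡ δ + C₁.colour e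
  colour-H₁ e e∈H₁ rewrite e∈H₁ = refl

  proper : IsEdgeColoring G colour
  proper e e' adj same with side e in se | side e' in se'
  ... | false | false = C₀.proper e e' (cong not se) (cong not se') adj same
  ... | true  | true  = C₁.proper e e' se se' adj (+-cancelˡ-≡ δ _ _ same)
  ... | false | true  = <-irrefl same (<-≤-trans (C₀.colour<K e (cong not se)) (m≤m+n δ _))
  ... | true  | false = <-irrefl (sym same) (<-≤-trans (C₀.colour<K e' (cong not se')) (m≤m+n δ _))

  paletteIncluded : ∀ {u v} → V₁ u ≡ V₁ v → ∀ k →
    _∈Palette[_]_ G k colour u → _∈Palette[_]_ G k colour v
  paletteIncluded {u} {v} sameSide k (e , e~u , refl) with side e in se
  ... | false = let (e' , e'∈H₀ , e'~v , same) = C₀.spread e (cong not se) v tt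
                in e' , e'~v , trans (colour-H₀ e' (not-injective e'∈H₀)) same
  ... | true  = let (e' , e'∈H₁ , e'~v , same) = C₁.spread e se v (trans (sym sameSide) (H₁⊆V₁ e~u se))
                in e' , e'~v , trans (colour-H₁ e' e'∈H₁) (cong (δ +_) same)

  sameSide⇒samePalette : ∀ {u v} → V₁ u ≡ V₁ v → SamePalette G colour u v
  sameSide⇒samePalette sameSide k = mk⇔ (paletteIncluded sameSide k) (paletteIncluded (sym sameSide) k)

sufficiency : ∀ (G : Multigraph) {Δ δ} → IsMaxDegree G Δ → IsMinDegree G δ → δ < Δ →
  GoodDecomposition G Δ δ → PaletteIndex≡ G 2
sufficiency G {Δ} {δ} ((vΔ , degΔ) , _) ((vδ , degδ) , _) δ<Δ (side , V₁ , endpoints , H₀ , H₁) =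
  (colour , proper , representative , covers) , ¬onePalette
  where
  open Multigraph G

  H₁⊆V₁ : ∀ {e u} → Inc G e u → side e ≡ true → V₁ u ≡ true
  H₁⊆V₁ (inj₁ refl) e∈H₁ = proj₁ (endpoints _ e∈H₁)
  H₁⊆V₁ (inj₂ refl) e∈H₁ = proj₂ (endpoints _ e∈H₁)

  C₀ : SpreadColouring G (not ∘ side) (const ⊤) δ
  C₀ = spreadColouring G (any? (λ e → not (side e) Bool.≟ true))
         (λ (e , e∈H₀) → let (regular , colouring) = H₀ (e , not-injective e∈H₀)
                         in (λ v _ → regular v) , colouring)

  C₁ : SpreadColouring G side (λ v → V₁ v ≡ true) (Δ ∸ δ)
  C₁ = spreadColouring G (any? (λ e → side e Bool.≟ true)) H₁

  open CombinedColouring G side V₁ H₁⊆V₁ C₀ C₁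

  Δ≢δ : Δ ≢ δ
  Δ≢δ = <⇒≢ δ<Δ ∘ sym

  sidesDiffer : V₁ vΔ ≢ V₁ vδ
  sidesDiffer sameSide =
    Δ≢δ (trans (sym degΔ) (trans (samePalette⇒deg≡ G proper (sameSide⇒samePalette sameSide)) degδ))

  representative : Fin 2 → Fin n
  representative zero = vΔ
  representative (suc _) = vδ

  covers : ∀ v → ∃ λ i → SamePalette G colour v (representative i)
  covers v with V₁ v Bool.≟ V₁ vΔ
  ... | yes sameSide = zero , sameSide⇒samePalette sameSide
  ... | no otherSide =
        suc zero , sameSide⇒samePalette (trans (¬-not otherSide) (sym (¬-not (sidesDiffer ∘ sym))))

  ¬onePalette : ¬ PaletteIndex≤ G 1
  ¬onePalette one = Δ≢δ (trans (sym degΔ) (trans (onePalette⇒deg≡ G one vΔ vδ) degδ))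

module _ (G : Multigraph) (a₀ b₀ : Fin (Multigraph.n G)) where
  open Multigraph G

  record TwoPaletteColouring (c : Fin m → ℕ) : Set where
    field
      proper : IsEdgeColoring G c
      palettes : ∀ v → SamePalette G c v a₀ ⊎ SamePalette G c v b₀

  surplus : (Fin m → ℕ) → ℕ
  surplus c = length (filter (_∉? coloursAt G c a₀) (coloursAt G c b₀))

  module Recolouring {c : Fin m → ℕ} (twoPalettes : TwoPaletteColouring c)
                     {a b : ℕ} (a∈A : a ∈ coloursAt G c a₀) (a∉B : a ∉ coloursAt G c b₀)
                     (b∈B : b ∈ coloursAt G c b₀) (b∉A : b ∉ coloursAt G c a₀) where
    open TwoPaletteColouring twoPalettes

    A : List ℕ
    A = coloursAt G c a₀

    replace : ℕ → ℕ
    replace k with k ℕ.≟ b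
    ... | yes _ = a
    ... | no _ = k

    replace-b : replace b ≡ a
    replace-b with b ℕ.≟ b
    ... | yes _ = refl
    ... | no b≢b = ⊥-elim (b≢b refl)

    replace-≢ : ∀ {k} → k ≢ b → replace k ≡ k
    replace-≢ {k} k≢b with k ℕ.≟ b
    ... | yes k≡b = ⊥-elim (k≢b k≡b)
    ... | no _ = refl

    ∈A⇒≢b : ∀ {k} → k ∈ A → k ≢ b
    ∈A⇒≢b k∈A refl = b∉A k∈A

    noCommonVertex : ∀ {e e' v} → Inc G e v → Inc G e' v → c e ≡ b → c e' ≢ a
    noCommonVertex {e} {e'} {v} e~v e'~v ce≡b ce'≡a with palettes v
    ... | inj₁ v~a₀ = b∉A (from (∈-coloursAt⇔∈Palette G) (to (v~a₀ b) (e , e~v , ce≡b)))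
    ... | inj₂ v~b₀ = a∉B (from (∈-coloursAt⇔∈Palette G) (to (v~b₀ a) (e' , e'~v , ce'≡a)))

    proper' : IsEdgeColoring G (replace ∘ c)
    proper' e e' adj@(_ , v , e~v , e'~v) same = compare (c e ℕ.≟ b) (c e' ℕ.≟ b)
      where
      compare : Dec (c e ≡ b) → Dec (c e' ≡ b) → ⊥
      compare (yes ce≡b) (yes ce'≡b) = proper e e' adj (trans ce≡b (sym ce'≡b))
      compare (no ce≢b) (no ce'≢b) =
        proper e e' adj (trans (sym (replace-≢ ce≢b)) (trans same (replace-≢ ce'≢b)))
      compare (yes ce≡b) (no ce'≢b) = noCommonVertex e~v e'~v ce≡b
        (trans (sym (replace-≢ ce'≢b)) (trans (sym same) (trans (cong replace ce≡b) replace-b)))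
      compare (no ce≢b) (yes ce'≡b) = noCommonVertex e'~v e~v ce'≡b
        (trans (sym (replace-≢ ce≢b)) (trans same (trans (cong replace ce'≡b) replace-b)))

    recoloured : TwoPaletteColouring (replace ∘ c)
    recoloured = record
      { proper = proper'
      ; palettes = λ v → Sum.map (samePalette-∘ G replace) (samePalette-∘ G replace) (palettes v)
      }

    coloursAt-a₀-unchanged : coloursAt G (replace ∘ c) a₀ ≡ A
    coloursAt-a₀-unchanged = map-cong-local (All.tabulate (λ e∈ → replace-≢ (∈A⇒≢b (∈-map⁺ c e∈))))

    surplus-decreases : surplus (replace ∘ c) < surplus c
    surplus-decreases with e , e∈ , refl ← ∈-map⁻ c b∈B = begin-strict
      surplus (replace ∘ c)                                   ≡⟨ cong surplusOver coloursAt-a₀-unchanged ⟩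
      length (filter (_∉? A) (map (replace ∘ c) (edgesAt G b₀)))
        <⟨ length-filter-map-< (_∉? A) c (replace ∘ c) staysOutside (edgesAt G b₀) e∈ b∉A
             (λ a∉A → a∉A (subst (_∈ A) (sym replace-b) a∈A)) ⟩
      surplus c                                               ∎
      where
      open ≤-Reasoning
      surplusOver : List ℕ → ℕ
      surplusOver X = length (filter (_∉? X) (map (replace ∘ c) (edgesAt G b₀)))
      staysOutside : ∀ e → replace (c e) ∉ A → c e ∉ A
      staysOutside e r∉A ce∈A = r∉A (subst (_∈ A) (sym (replace-≢ (∈A⇒≢b ce∈A))) ce∈A)

  missingColour : ∀ {c b} → TwoPaletteColouring c → deg G b₀ ≤ deg G a₀ →
    b ∈ coloursAt G c b₀ → b ∉ coloursAt G c a₀ → ∃ λ a → a ∈ coloursAt G c a₀ × a ∉ coloursAt G c b₀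
  missingColour {c} twoPalettes b₀≤a₀ =
    unique-length≤-∉⇒∃∉ ℕ._≟_ (coloursAt-unique G proper a₀) (coloursAt-unique G proper b₀)
      (subst₂ _≤_ (sym (length-coloursAt G c b₀)) (sym (length-coloursAt G c a₀)) b₀≤a₀)
    where open TwoPaletteColouring twoPalettes

  nestPalettes : ∀ (fuel : ℕ) {c} → TwoPaletteColouring c → surplus c ≤ fuel → deg G b₀ ≤ deg G a₀ →
    ∃ λ c' → TwoPaletteColouring c' × coloursAt G c' b₀ ⊆ coloursAt G c' a₀
  nestPalettes fuel {c} twoPalettes bounded b₀≤a₀
    with ⊆-or-∃∉ ℕ._≟_ (coloursAt G c b₀) (coloursAt G c a₀)
  ... | inj₁ B⊆A = c , twoPalettes , B⊆A
  ... | inj₂ (b , b∈B , b∉A) with fuel | missingColour twoPalettes b₀≤a₀ b∈B b∉A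
  ...   | zero | _ =
          ⊥-elim (n≮0 (<-≤-trans (filter-some (_∉? coloursAt G c a₀) (lose b∈B b∉A)) bounded))
  ...   | suc fuel' | a , a∈A , a∉B =
          nestPalettes fuel' recoloured (≤-pred (≤-trans surplus-decreases bounded)) b₀≤a₀
    where open Recolouring twoPalettes a∈A a∉B b∈B b∉A

  module Nested {c : Fin m → ℕ} (twoPalettes : TwoPaletteColouring c)
                (B⊆A : coloursAt G c b₀ ⊆ coloursAt G c a₀) where
    open TwoPaletteColouring twoPalettes

    A B : List ℕ
    A = coloursAt G c a₀
    B = coloursAt G c b₀

    A! : Unique A
    A! = coloursAt-unique G proper a₀

    B! : Unique B
    B! = coloursAt-unique G proper b₀

    B⊆palette : ∀ v {k} → k ∈ B → _∈Palette[_]_ G k c v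
    B⊆palette v {k} k∈B with palettes v
    ... | inj₁ v~a₀ = from (v~a₀ k) (to (∈-coloursAt⇔∈Palette G) (B⊆A k∈B))
    ... | inj₂ v~b₀ = from (v~b₀ k) (to (∈-coloursAt⇔∈Palette G) k∈B)

    equalDegrees⇒onePalette : deg G b₀ ≡ deg G a₀ → PaletteIndex≤ G 1
    equalDegrees⇒onePalette b₀≡a₀ = c , proper , const a₀ , λ v → zero , v~a₀ v
      where
      A⊆B : A ⊆ B
      A⊆B = unique-⊆-length≥⇒⊇ ℕ._≟_ B! A! B⊆A
              (subst₂ _≤_ (sym (length-coloursAt G c a₀)) (sym (length-coloursAt G c b₀)) (≤-reflexive (sym b₀≡a₀)))
      b₀~a₀ : SamePalette G c b₀ a₀
      b₀~a₀ k = mk⇔ (to ∈P ∘ B⊆A ∘ from ∈P) (to ∈P ∘ A⊆B ∘ from ∈P)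
        where
        ∈P : ∀ {v} → k ∈ coloursAt G c v ⇔ _∈Palette[_]_ G k c v
        ∈P = ∈-coloursAt⇔∈Palette G
      v~a₀ : ∀ v → SamePalette G c v a₀
      v~a₀ v with palettes v
      ... | inj₁ v~a₀ = v~a₀
      ... | inj₂ v~b₀ = λ k → b₀~a₀ k ⇔-∘ v~b₀ k

    side : Fin m → Bool
    side e = not (does (c e ∈? B))

    ∈H₀⇔ : ∀ e → not (side e) ≡ true ⇔ c e ∈ B
    ∈H₀⇔ e with c e ∈? B
    ... | yes ce∈B = mk⇔ (const ce∈B) (const refl)
    ... | no ce∉B = mk⇔ (λ ()) (⊥-elim ∘ ce∉B)

    ∈H₁⇔ : ∀ e → side e ≡ true ⇔ c e ∉ B
    ∈H₁⇔ e with c e ∈? B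
    ... | yes ce∈B = mk⇔ (λ ()) (λ ce∉B → ⊥-elim (ce∉B ce∈B))
    ... | no ce∉B = mk⇔ (const ce∉B) (const refl)

    V₁ : Fin n → Bool
    V₁ v = [ const true , const false ]′ (palettes v)

    V₁⇒samePalette : ∀ {v} → V₁ v ≡ true → SamePalette G c v a₀
    V₁⇒samePalette {v} V₁v with palettes v
    ... | inj₁ v~a₀ = v~a₀

    ∉B⇒V₁ : ∀ {e v} → Inc G e v → c e ∉ B → V₁ v ≡ true × c e ∈ A
    ∉B⇒V₁ {e} {v} e~v ce∉B with palettes v
    ... | inj₁ v~a₀ = refl , from (∈-coloursAt⇔∈Palette G) (to (v~a₀ (c e)) (e , e~v , refl))
    ... | inj₂ v~b₀ =
          ⊥-elim (ce∉B (from (∈-coloursAt⇔∈Palette G) (to (v~b₀ (c e)) (e , e~v , refl))))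

    H₀-regular : ∀ v → degIn G (not ∘ side) v ≡ deg G b₀
    H₀-regular v =
      trans (degIn≡length G B proper B! (λ e e∈H₀ _ → to (∈H₀⇔ e) e∈H₀) onto) (length-coloursAt G c b₀)
      where
      onto : ∀ {k} → k ∈ B → ∃ λ e → not (side e) ≡ true × Inc G e v × c e ≡ k
      onto k∈B with e , e~v , refl ← B⊆palette v k∈B = e , from (∈H₀⇔ e) k∈B , e~v , refl

    H₀-colouring : (∃ λ e → side e ≡ false) → HasColoringIn G (not ∘ side) (deg G b₀)
    H₀-colouring (e₀ , e₀∈H₀) = subst (HasColoringIn G (not ∘ side)) (length-coloursAt G c b₀)
      (colouringFromList G B proper (λ e → to (∈H₀⇔ e)) (e₀ , cong not e₀∈H₀))

    A∖B : List ℕ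
    A∖B = filter (_∉? B) A

    length-A∖B : length A∖B ≡ deg G a₀ ∸ deg G b₀
    length-A∖B = trans (length-filter-∉ ℕ._≟_ A! B! B⊆A)
                       (cong₂ _∸_ (length-coloursAt G c a₀) (length-coloursAt G c b₀))

    ∈A∖B : ∀ e → side e ≡ true → c e ∈ A∖B
    ∈A∖B e e∈H₁ = ∈-filter⁺ (_∉? B) (proj₂ (∉B⇒V₁ (inj₁ refl) ce∉B)) ce∉B
      where
      ce∉B : c e ∉ B
      ce∉B = to (∈H₁⇔ e) e∈H₁

    H₁-regular : ∀ v → V₁ v ≡ true → degIn G side v ≡ deg G a₀ ∸ deg G b₀
    H₁-regular v V₁v =
      trans (degIn≡length G A∖B proper (Unique.filter⁺ _ A!) (λ e e∈H₁ _ → ∈A∖B e e∈H₁) onto) length-A∖B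
      where
      onto : ∀ {k} → k ∈ A∖B → ∃ λ e → side e ≡ true × Inc G e v × c e ≡ k
      onto {k} k∈A∖B
        with k∈A , k∉B ← ∈-filter⁻ (_∉? B) {xs = A} k∈A∖B
        with e , e~v , refl ← from (V₁⇒samePalette V₁v k) (to (∈-coloursAt⇔∈Palette G) k∈A)
        = e , from (∈H₁⇔ e) k∉B , e~v , refl

    H₁-colouring : (∃ λ e → side e ≡ true) → HasColoringIn G side (deg G a₀ ∸ deg G b₀)
    H₁-colouring someEdge =
      subst (HasColoringIn G side) length-A∖B (colouringFromList G A∖B proper ∈A∖B someEdge)

    H₁-endpoints : ∀ e → side e ≡ true → (V₁ (src e) ≡ true) × (V₁ (tgt e) ≡ true)
    H₁-endpoints e e∈H₁ = proj₁ (∉B⇒V₁ (inj₁ refl) ce∉B) , proj₁ (∉B⇒V₁ (inj₂ refl) ce∉B)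
      where
      ce∉B : c e ∉ B
      ce∉B = to (∈H₁⇔ e) e∈H₁

    decomposition : GoodDecomposition G (deg G a₀) (deg G b₀)
    decomposition =
      side , V₁ , H₁-endpoints , (λ someEdge → H₀-regular , H₀-colouring someEdge)
                               , (λ someEdge → H₁-regular , H₁-colouring someEdge)

module _ (G : Multigraph) where
  open Multigraph G

  pairCover⇒⊎ : ∀ {c v} (w : Fin 2 → Fin n) → (∃ λ i → SamePalette G c v (w i)) →
    SamePalette G c v (w zero) ⊎ SamePalette G c v (w (suc zero))
  pairCover⇒⊎ w (zero , v~w₀) = inj₁ v~w₀
  pairCover⇒⊎ w (suc zero , v~w₁) = inj₂ v~w₁

  orderedRepresentatives : ∀ {c} (w : Fin 2 → Fin n) → (∀ v → ∃ λ i → SamePalette G c v (w i)) →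
    ∃₂ λ a₀ b₀ → deg G b₀ ≤ deg G a₀ × ∀ v → SamePalette G c v a₀ ⊎ SamePalette G c v b₀
  orderedRepresentatives w covers with ≤-total (deg G (w (suc zero))) (deg G (w zero))
  ... | inj₁ w₁≤w₀ = w zero , w (suc zero) , w₁≤w₀ , λ v → pairCover⇒⊎ w (covers v)
  ... | inj₂ w₀≤w₁ = w (suc zero) , w zero , w₀≤w₁ , λ v → Sum.swap (pairCover⇒⊎ w (covers v))

  maxDegree≡ : ∀ {Δ a b} → IsMaxDegree G Δ → (∀ v → deg G v ≡ deg G a ⊎ deg G v ≡ deg G b) →
    deg G b < deg G a → Δ ≡ deg G a
  maxDegree≡ {a = a} ((v , degv≡Δ) , ≤Δ) degrees b<a with degrees v
  ... | inj₁ degv≡a = trans (sym degv≡Δ) degv≡a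
  ... | inj₂ degv≡b =
        ⊥-elim (<-irrefl refl (<-≤-trans b<a (subst (deg G a ≤_) (trans (sym degv≡Δ) degv≡b) (≤Δ a))))

  minDegree≡ : ∀ {δ a b} → IsMinDegree G δ → (∀ v → deg G v ≡ deg G a ⊎ deg G v ≡ deg G b) →
    deg G b < deg G a → δ ≡ deg G b
  minDegree≡ {b = b} ((v , degv≡δ) , δ≤) degrees b<a with degrees v
  ... | inj₂ degv≡b = trans (sym degv≡δ) degv≡b
  ... | inj₁ degv≡a =
        ⊥-elim (<-irrefl refl (<-≤-trans b<a (subst (_≤ deg G b) (trans (sym degv≡δ) degv≡a) (δ≤ b))))

necessity : ∀ (G : Multigraph) {Δ δ} → IsMaxDegree G Δ → IsMinDegree G δ → PaletteIndex≡ G 2 →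
  δ < Δ × GoodDecomposition G Δ δ
necessity G maxΔ minδ ((c , proper , w , covers) , ¬onePalette)
  with a₀ , b₀ , b₀≤a₀ , palettes ← orderedRepresentatives G w covers
  with c' , twoPalettes' , B⊆A ←
         nestPalettes G a₀ b₀ _ (record { proper = proper ; palettes = palettes }) ≤-refl b₀≤a₀
  with m≤n⇒m<n∨m≡n b₀≤a₀
... | inj₂ b₀≡a₀ =
  ⊥-elim (¬onePalette (Nested.equalDegrees⇒onePalette G a₀ b₀ twoPalettes' B⊆A b₀≡a₀))
... | inj₁ b₀<a₀ =
  subst₂ (λ Δ δ → δ < Δ × GoodDecomposition G Δ δ)
    (sym (maxDegree≡ G maxΔ degrees b₀<a₀)) (sym (minDegree≡ G minδ degrees b₀<a₀))
    (b₀<a₀ , Nested.decomposition G a₀ b₀ twoPalettes' B⊆A)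
  where
  degrees : ∀ v → deg G v ≡ deg G a₀ ⊎ deg G v ≡ deg G b₀
  degrees v = Sum.map (samePalette⇒deg≡ G proper) (samePalette⇒deg≡ G proper) (palettes v)

theorem6 : (G : Multigraph) (Δ δ : ℕ) → IsMaxDegree G Δ → IsMinDegree G δ →
    PaletteIndex≡ G 2 ⇔ ((δ < Δ) × GoodDecomposition G Δ δ)
theorem6 G Δ δ maxΔ minδ =
  mk⇔ (necessity G maxΔ minδ) (λ (δ<Δ , decomposition) → sufficiency G maxΔ minδ δ<Δ decomposition)
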